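{- For $n\ge 0$ and $0\le k\le n$ let $r(n,k)$ be the number of rooks $r\in R_n$ with $\mathrm{PZ}(r)=k$, and set $r(n,k)=0$ if $k<0$ or $k>n$. Then for all $n>0$ and all $k$, $$r(n,k)=k\,r(n-1,k-1)+(n-k-1)\,r(n-1,k)+\sum_{i=k}^{n}r(n-1,i).$$
   Context: A rook of size $n$ is a word $r=r_1\dots r_n$ over $\{0,1,\dots,n\}$ whose nonzero letters are pairwise distinct; $R_n$ denotes the set of these. For $r\in R_n$, $\mathrm{PZ}(r)=\min\{j\le n: r_j=0\}-1$ if $r$ contains a $0$, and $\mathrm{PZ}(r)=n$ otherwise. -}

module Defs where

open import Data.Nat as ℕ using (ℕ; zero; suc)
import Data.Nat.Properties as ℕP
open import Data.Integer as ℤ using (ℤ; +_; -[1+_]; _+_; _*_; _-_)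
open import Data.List using (List; []; _∷_; length; filter; map; concatMap; upTo; sum)
open import Data.List.Relation.Unary.Unique.Propositional using (Unique)
open import Data.List.Relation.Unary.Unique.DecPropositional ℕP._≟_ using (unique?)
open import Relation.Nullary using (Dec; yes; no; ¬_)
open import Relation.Nullary.Decidable using (¬?)
open import Relation.Binary.PropositionalEquality using (_≡_)

words : (n len : ℕ) → List (List ℕ)
words n zero = [] ∷ []
words n (suc len) = concatMap (λ a → map (a ∷_) (words n len)) (upTo (suc n))

nonzeros : List ℕ → List ℕ
nonzeros = filter (λ a → ¬? (a ℕP.≟ 0))

IsRook : List ℕ → Set
IsRook w = Unique (nonzeros w)

isRook? : (w : List ℕ) → Dec (IsRook w)
isRook? w = unique? (nonzeros w)

rooks : ℕ → List (List ℕ)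
rooks n = filter isRook? (words n n)

PZ : List ℕ → ℕ
PZ [] = 0
PZ (zero ∷ w) = 0
PZ (suc _ ∷ w) = suc (PZ w)

rℕ : ℕ → ℕ → ℕ
rℕ n k = length (filter (λ w → PZ w ℕP.≟ k) (rooks n))

r : ℕ → ℤ → ℤ
r n (+ k) with k ℕ.≤? n
... | yes _ = + rℕ n k
... | no _ = + 0
r n -[1+ _ ] = + 0

sumFrom : ℤ → ℕ → (ℤ → ℤ) → ℤ
sumFrom a zero f = + 0
sumFrom a (suc j) f = sumFrom a j f + f (a + + j)

countFromTo : ℤ → ℤ → ℕ
countFromTo a b with b - a
... | + d = suc d
... | -[1+ _ ] = 0

sumFromTo : ℤ → ℤ → (ℤ → ℤ) → ℤ
sumFromTo a b f = sumFrom a (countFromTo a b) f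

-- Count words by their first letter. Let rookCount a L be the number of words of length L over 0 and
-- a free letters whose nonzero letters are distinct, and rookCountPZ a L k the number of those with
-- PZ = k. A first letter 0 gives rookCountPZ a (L+1) 0 = rookCount a L, and each of the a free first
-- letters leaves a - 1 free letters, so rookCountPZ a (L+1) (k+1) = a * rookCountPZ (a-1) L k; then
-- r(n,k) = rookCountPZ n n k. Enlarging the alphabet by one letter (absent, or in one of L+1 places)
-- gives rookCount (a+1) (L+1) = rookCount a (L+1) + (L+1) * rookCount a L. With f = r(m,.), the
-- recurrence at k = j+1 amounts to (m-j) f(j) = (m-j-1) f(j+1) + sum_{i>j} f(i), which passes from
-- m-1 to m because r(m,i+1) = m * r(m-1,i); at j = 0, and at k = 0, it is the alphabet identity.

module Submission where

open import Defs
open import Data.Bool using (true; false; if_then_else_)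
open import Data.Nat as ℕ using (ℕ; zero; suc; pred; _∸_; _≤_; _<_; z≤n; s≤s)
import Data.Nat.Properties as ℕP
open import Algebra.Properties.CommutativeSemigroup ℕP.+-commutativeSemigroup using () renaming (interchange to +-interchange)
open import Algebra.Properties.CommutativeSemigroup ℕP.*-commutativeSemigroup using () renaming (x∙yz≈y∙xz to *-left-comm)
open import Data.Nat.Tactic.RingSolver using (solve-∀)
open import Data.List using (List; []; _∷_; _++_; length; filter; map; concatMap; applyUpTo)
open import Data.List.Properties using (length-++; filter-++; filter-≐; filter-none; filter-accept; ++-identityʳ)
open import Data.List.Membership.Propositional using (_∈_; _∉_)
open import Data.List.Membership.Propositional.Properties using (∈-++⁺ˡ)
open import Data.List.Membership.DecPropositional ℕP._≟_ using (_∈?_; _∉?_)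
open import Data.List.Relation.Unary.All as All using (All; []; _∷_)
open import Data.List.Relation.Unary.All.Properties using (¬Any⇒All¬; All¬⇒¬Any)
open import Data.List.Relation.Unary.AllPairs using ([]; _∷_)
open import Data.List.Relation.Unary.Unique.Propositional using (Unique)
open import Data.List.Relation.Unary.Unique.DecPropositional ℕP._≟_ using (unique?)
open import Data.List.Relation.Binary.Permutation.Propositional using (_↭_; ↭⇒↭ₛ; ↭-sym)
open import Data.List.Relation.Binary.Permutation.Propositional.Properties using (shift)
import Data.List.Relation.Binary.Permutation.Setoid.Properties as Permₛ
open import Data.Product using (_×_; _,_; proj₂)
open import Data.Sum using (inj₁; inj₂)
open import Function using (_∘_)
open import Level using (0ℓ)
open import Relation.Nullary using (Dec; yes; no; ¬_; does; ¬?; contradiction)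
open import Relation.Nullary.Decidable using (_⊎-dec_)
open import Relation.Unary using (Pred; Decidable; _≐_; U)
open import Relation.Unary.Properties using (U?; _∩?_)
open import Relation.Binary.PropositionalEquality

module RookCounting where

  open import Data.Nat using (_+_; _*_)

  private
    variable
      A B : Set

  count : {P : Pred A 0ℓ} → Decidable P → List A → ℕ
  count P? xs = length (filter P? xs)

  module _ {P : Pred A 0ℓ} (P? : Decidable P) where

    count-none : (∀ x → ¬ P x) → ∀ xs → count P? xs ≡ 0
    count-none ¬P xs = cong length (filter-none P? (All.universal ¬P xs))

    count-++ : ∀ xs ys → count P? (xs ++ ys) ≡ count P? xs + count P? ys
    count-++ xs ys = trans (cong length (filter-++ P? xs ys)) (length-++ (filter P? xs))

    count-map : (f : B → A) → ∀ xs → count P? (map f xs) ≡ count (P? ∘ f) xs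
    count-map f [] = refl
    count-map f (x ∷ xs) with does (P? (f x))
    ... | true = cong suc (count-map f xs)
    ... | false = count-map f xs

  count-≐ : {P Q : Pred A 0ℓ} (P? : Decidable P) (Q? : Decidable Q) → P ≐ Q → ∀ xs → count P? xs ≡ count Q? xs
  count-≐ P? Q? P≐Q xs = cong length (filter-≐ P? Q? P≐Q xs)

  count-filter : {P Q : Pred A 0ℓ} (P? : Decidable P) (Q? : Decidable Q) →
    ∀ xs → length (filter P? (filter Q? xs)) ≡ count (P? ∩? Q?) xs
  count-filter P? Q? [] = refl
  count-filter P? Q? (x ∷ xs) with Q? x
  ... | yes _ with P? x
  ...   | yes _ = cong suc (count-filter P? Q? xs)
  ...   | no _ = count-filter P? Q? xs
  count-filter P? Q? (x ∷ xs) | no _ with P? x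
  ...   | yes _ = count-filter P? Q? xs
  ...   | no _ = count-filter P? Q? xs

  ∑< : ℕ → (ℕ → ℕ) → ℕ
  ∑< zero f = 0
  ∑< (suc n) f = f 0 + ∑< n (f ∘ suc)

  syntax ∑< n (λ i → e) = ∑[ i < n ] e

  ∑-cong : ∀ n {f g : ℕ → ℕ} → (∀ i → i < n → f i ≡ g i) → ∑< n f ≡ ∑< n g
  ∑-cong zero f≡g = refl
  ∑-cong (suc n) f≡g = cong₂ _+_ (f≡g 0 (s≤s z≤n)) (∑-cong n (λ i i<n → f≡g (suc i) (s≤s i<n)))

  ∑-zero : ∀ n → ∑[ i < n ] 0 ≡ 0
  ∑-zero zero = refl
  ∑-zero (suc n) = ∑-zero n

  ∑-one : ∀ n → ∑[ i < n ] 1 ≡ n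
  ∑-one zero = refl
  ∑-one (suc n) = cong suc (∑-one n)

  ∑-+ : ∀ n (f g : ℕ → ℕ) → ∑[ i < n ] (f i + g i) ≡ ∑< n f + ∑< n g
  ∑-+ zero f g = refl
  ∑-+ (suc n) f g = trans (cong ((f 0 + g 0) +_) (∑-+ n (f ∘ suc) (g ∘ suc))) (+-interchange (f 0) (g 0) _ _)

  ∑-*ˡ : ∀ n c (f : ℕ → ℕ) → ∑[ i < n ] (c * f i) ≡ c * ∑< n f
  ∑-*ˡ zero c f = sym (ℕP.*-zeroʳ c)
  ∑-*ˡ (suc n) c f = trans (cong (c * f 0 +_) (∑-*ˡ n c (f ∘ suc))) (sym (ℕP.*-distribˡ-+ c (f 0) _))

  ∑-*ʳ : ∀ n c (f : ℕ → ℕ) → ∑[ i < n ] (f i * c) ≡ ∑< n f * c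
  ∑-*ʳ zero c f = refl
  ∑-*ʳ (suc n) c f = trans (cong (f 0 * c +_) (∑-*ʳ n c (f ∘ suc))) (sym (ℕP.*-distribʳ-+ c (f 0) _))

  ∑-snoc : ∀ n (f : ℕ → ℕ) → ∑< (suc n) f ≡ ∑< n f + f n
  ∑-snoc zero f = ℕP.+-comm (f 0) 0
  ∑-snoc (suc n) f = trans (cong (f 0 +_) (∑-snoc n (f ∘ suc))) (sym (ℕP.+-assoc (f 0) _ _))

  count-concatMap : {P : Pred B 0ℓ} (P? : Decidable P) (f : A → List B) (g : ℕ → A) →
    ∀ n → count P? (concatMap f (applyUpTo g n)) ≡ ∑[ i < n ] count P? (f (g i))
  count-concatMap P? f g zero = refl
  count-concatMap P? f g (suc n) =
    trans (count-++ P? (f (g 0)) _) (cong (count P? (f (g 0)) +_) (count-concatMap P? f (g ∘ suc) n))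

  count-words-suc : {P : Pred (List ℕ) 0ℓ} (P? : Decidable P) → ∀ n L →
    count P? (words n (suc L)) ≡
      count (P? ∘ (0 ∷_)) (words n L) + ∑[ b < n ] count (P? ∘ (suc b ∷_)) (words n L)
  count-words-suc P? n L =
    trans (count-concatMap P? (λ a → map (a ∷_) (words n L)) (λ a → a) (suc n))
          (cong₂ _+_ (count-map P? (0 ∷_) (words n L))
                     (∑-cong n (λ b _ → count-map P? (suc b ∷_) (words n L))))

  𝟙 : {P : Set} → Dec P → ℕ
  𝟙 P? = if does P? then 1 else 0

  𝟙-+-𝟙-¬ : {P : Set} (P? : Dec P) → 𝟙 P? + 𝟙 (¬? P?) ≡ 1
  𝟙-+-𝟙-¬ (yes _) = refl
  𝟙-+-𝟙-¬ (no _) = refl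

  ∑-𝟙-≟ : ∀ {n y} → y < n → ∑[ b < n ] 𝟙 (b ℕP.≟ y) ≡ 1
  ∑-𝟙-≟ {suc n} {zero} _ = cong suc (∑-zero n)
  ∑-𝟙-≟ {suc n} {suc y} (s≤s y<n) = ∑-𝟙-≟ y<n

  𝟙-⊎ : {P Q : Set} (P? : Dec P) (Q? : Dec Q) → ¬ (P × Q) → 𝟙 (P? ⊎-dec Q?) ≡ 𝟙 P? + 𝟙 Q?
  𝟙-⊎ (yes p) (yes q) ¬pq = contradiction (p , q) ¬pq
  𝟙-⊎ (yes _) (no _) _ = refl
  𝟙-⊎ (no _) _ _ = refl

  𝟙-∈-∷ : ∀ x {y S} → y ∉ S → 𝟙 (x ∈? y ∷ S) ≡ 𝟙 (x ℕP.≟ y) + 𝟙 (x ∈? S)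
  𝟙-∈-∷ x {y} {S} y∉S = 𝟙-⊎ (x ℕP.≟ y) (x ∈? S) (λ { (refl , y∈S) → y∉S y∈S })

  LetterSet : ℕ → List ℕ → Set
  LetterSet n S = Unique S × All (λ y → 1 ≤ y × y ≤ n) S

  ∑-𝟙-∈ : ∀ {n S} → LetterSet n S → ∑[ b < n ] 𝟙 (suc b ∈? S) ≡ length S
  ∑-𝟙-∈ {n} ([] , []) = ∑-zero n
  ∑-𝟙-∈ {n} {suc y ∷ S} ((y∉S ∷ S!) , ((s≤s z≤n , y<n) ∷ S⊆)) = begin
    ∑[ b < n ] 𝟙 (suc b ∈? suc y ∷ S)
      -- 𝟙 (suc b ≟ suc y) reduces to 𝟙 (b ≟ y)
      ≡⟨ ∑-cong n (λ b _ → 𝟙-∈-∷ (suc b) (All¬⇒¬Any y∉S)) ⟩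
    ∑[ b < n ] (𝟙 (b ℕP.≟ y) + 𝟙 (suc b ∈? S))
      ≡⟨ ∑-+ n _ _ ⟩
    ∑[ b < n ] 𝟙 (b ℕP.≟ y) + ∑[ b < n ] 𝟙 (suc b ∈? S)
      ≡⟨ cong₂ _+_ (∑-𝟙-≟ y<n) (∑-𝟙-∈ (S! , S⊆)) ⟩
    suc (length S) ∎
    where open ≡-Reasoning

  ∑-𝟙-∉ : ∀ {n S} → LetterSet n S → ∑[ b < n ] 𝟙 (suc b ∉? S) ≡ n ∸ length S
  ∑-𝟙-∉ {n} {S} S-letters = begin
    ∑∉                           ≡⟨ ℕP.m+n∸m≡n (length S) ∑∉ ⟨
    length S + ∑∉ ∸ length S     ≡⟨ cong (λ s → s + ∑∉ ∸ length S) (∑-𝟙-∈ S-letters) ⟨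
    ∑∈ + ∑∉ ∸ length S           ≡⟨ cong (_∸ length S) (∑-+ n _ _) ⟨
    ∑[ b < n ] (𝟙 (suc b ∈? S) + 𝟙 (suc b ∉? S)) ∸ length S
      ≡⟨ cong (_∸ length S) (trans (∑-cong n (λ b _ → 𝟙-+-𝟙-¬ (suc b ∈? S))) (∑-one n)) ⟩
    n ∸ length S                 ∎
    where
    open ≡-Reasoning
    ∑∈ = ∑[ b < n ] 𝟙 (suc b ∈? S)
    ∑∉ = ∑[ b < n ] 𝟙 (suc b ∉? S)

  ∑-fresh : ∀ {n S} X (g : ℕ → ℕ) → LetterSet n S →
    (∀ b → b < n → suc b ∈ S → g b ≡ 0) → (∀ b → b < n → suc b ∉ S → g b ≡ X) →
    ∑< n g ≡ (n ∸ length S) * X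
  ∑-fresh {n} {S} X g S-letters used fresh = begin
    ∑< n g                            ≡⟨ ∑-cong n indicator ⟩
    ∑[ b < n ] (𝟙 (suc b ∉? S) * X)   ≡⟨ ∑-*ʳ n X _ ⟩
    ∑[ b < n ] 𝟙 (suc b ∉? S) * X     ≡⟨ cong (_* X) (∑-𝟙-∉ S-letters) ⟩
    (n ∸ length S) * X                ∎
    where
    open ≡-Reasoning
    indicator : ∀ b → b < n → g b ≡ 𝟙 (suc b ∉? S) * X
    indicator b b<n with suc b ∈? S
    ... | yes b∈S = used b b<n b∈S
    ... | no b∉S = trans (fresh b b<n b∉S) (sym (ℕP.+-identityʳ X))

  Avoids : List ℕ → List ℕ → Set
  Avoids S w = Unique (S ++ nonzeros w)

  avoids? : ∀ S → Decidable (Avoids S)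
  avoids? S w = unique? (S ++ nonzeros w)

  Avoids-[] : ∀ {S} → Unique S → Avoids S []
  Avoids-[] {S} S! = subst Unique (sym (++-identityʳ S)) S!

  Unique-resp-↭ : {xs ys : List ℕ} → xs ↭ ys → Unique xs → Unique ys
  Unique-resp-↭ xs↭ys = Permₛ.Unique-resp-↭ (setoid ℕ) (↭⇒↭ₛ xs↭ys)

  Avoids-∷⁺ : ∀ S b w → Avoids S (suc b ∷ w) → Avoids (suc b ∷ S) w
  Avoids-∷⁺ S b w = Unique-resp-↭ (shift (suc b) S (nonzeros w))

  Avoids-∷⁻ : ∀ S b w → Avoids (suc b ∷ S) w → Avoids S (suc b ∷ w)
  Avoids-∷⁻ S b w = Unique-resp-↭ (↭-sym (shift (suc b) S (nonzeros w)))

  ∈⇒¬Avoids-∷ : ∀ {S b} w → suc b ∈ S → ¬ Avoids S (suc b ∷ w)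
  ∈⇒¬Avoids-∷ {S} {b} w b∈S avoids with Avoids-∷⁺ S b w avoids
  ... | b∉S++w ∷ _ = All.lookup b∉S++w (∈-++⁺ˡ b∈S) refl

  LetterSet-∷ : ∀ {n S b} → LetterSet n S → b < n → suc b ∉ S → LetterSet n (suc b ∷ S)
  LetterSet-∷ {S = S} (S! , S⊆) b<n b∉S = (¬Any⇒All¬ S b∉S ∷ S!) , ((s≤s z≤n , b<n) ∷ S⊆)

  count-words-suc-avoiding : ∀ {n L S} {P : Pred (List ℕ) 0ℓ} (P? : Decidable P) X → LetterSet n S →
    (∀ b → b < n → LetterSet n (suc b ∷ S) →
       count ((P? ∘ (suc b ∷_)) ∩? avoids? (suc b ∷ S)) (words n L) ≡ X) →
    count (P? ∩? avoids? S) (words n (suc L)) ≡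
      count ((P? ∘ (0 ∷_)) ∩? avoids? S) (words n L) + (n ∸ length S) * X
  count-words-suc-avoiding {n} {L} {S} P? X S-letters count-fresh =
    trans (count-words-suc (P? ∩? avoids? S) n L)
          (cong (count ((P? ∘ (0 ∷_)) ∩? avoids? S) (words n L) +_)
                (∑-fresh X _ S-letters used fresh))
    where
    used : ∀ b → b < n → suc b ∈ S → count ((P? ∩? avoids? S) ∘ (suc b ∷_)) (words n L) ≡ 0
    used b _ b∈S = count-none _ (λ w Pw×avoids → ∈⇒¬Avoids-∷ w b∈S (proj₂ Pw×avoids)) (words n L)
    fresh : ∀ b → b < n → suc b ∉ S → count ((P? ∩? avoids? S) ∘ (suc b ∷_)) (words n L) ≡ X
    fresh b b<n b∉S =
      trans (count-≐ _ _ ((λ {w} (Pw , a) → Pw , Avoids-∷⁺ S b w a) , (λ {w} (Pw , a) → Pw , Avoids-∷⁻ S b w a)) (words n L))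
            (count-fresh b b<n (LetterSet-∷ S-letters b<n b∉S))

  rookCount : ℕ → ℕ → ℕ
  rookCount a zero = 1
  rookCount a (suc L) = rookCount a L + a * rookCount (pred a) L

  rookCountPZ : ℕ → ℕ → ℕ → ℕ
  rookCountPZ a zero zero = 1
  rookCountPZ a zero (suc k) = 0
  rookCountPZ a (suc L) zero = rookCount a L
  rookCountPZ a (suc L) (suc k) = a * rookCountPZ (pred a) L k

  PZ≟ : ∀ k → Decidable (λ w → PZ w ≡ k)
  PZ≟ k w = PZ w ℕP.≟ k

  count-avoiding : ∀ {n} L {S} → LetterSet n S → count (U? ∩? avoids? S) (words n L) ≡ rookCount (n ∸ length S) L
  count-avoiding zero {S} (S! , _) = cong length (filter-accept (U? ∩? avoids? S) {[]} {[]} (_ , Avoids-[] S!))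
  count-avoiding {n} (suc L) {S} S-letters =
    trans (count-words-suc-avoiding {L = L} U? _ S-letters
            (λ b _ bS-letters → trans (count-avoiding L bS-letters) rookCount-pred))
          (cong (_+ (n ∸ length S) * rookCount (pred (n ∸ length S)) L) (count-avoiding L S-letters))
    where
    rookCount-pred : rookCount (n ∸ suc (length S)) L ≡ rookCount (pred (n ∸ length S)) L
    rookCount-pred = cong (λ a → rookCount a L) (sym (ℕP.pred[m∸n]≡m∸[1+n] n (length S)))

  count-avoiding-PZ : ∀ {n} L k {S} → LetterSet n S →
    count (PZ≟ k ∩? avoids? S) (words n L) ≡ rookCountPZ (n ∸ length S) L k
  count-avoiding-PZ zero zero {S} (S! , _) =
    cong length (filter-accept (PZ≟ 0 ∩? avoids? S) {[]} {[]} (refl , Avoids-[] S!))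
  count-avoiding-PZ zero (suc k) _ = refl
  count-avoiding-PZ {n} (suc L) zero {S} S-letters = begin
    count (PZ≟ 0 ∩? avoids? S) (words n (suc L))
      ≡⟨ count-words-suc-avoiding {L = L} (PZ≟ 0) 0 S-letters
           (λ b _ _ → count-none ((PZ≟ 0 ∘ (suc b ∷_)) ∩? avoids? (suc b ∷ S))
                                 (λ _ (1+PZ≡0 , _) → ℕP.1+n≢0 1+PZ≡0) (words n L)) ⟩
    count ((PZ≟ 0 ∘ (0 ∷_)) ∩? avoids? S) (words n L) + (n ∸ length S) * 0
      ≡⟨ cong₂ _+_ (count-≐ _ (U? ∩? avoids? S) zero-first (words n L)) (ℕP.*-zeroʳ (n ∸ length S)) ⟩
    count (U? ∩? avoids? S) (words n L) + 0
      ≡⟨ trans (ℕP.+-identityʳ _) (count-avoiding L S-letters) ⟩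
    rookCount (n ∸ length S) L ∎
    where
    open ≡-Reasoning
    zero-first : (λ w → PZ (0 ∷ w) ≡ 0 × Avoids S w) ≐ (λ w → U w × Avoids S w)
    zero-first = (λ (_ , avoids) → _ , avoids) , (λ (_ , avoids) → refl , avoids)
  count-avoiding-PZ {n} (suc L) (suc k) {S} S-letters = begin
    count (PZ≟ (suc k) ∩? avoids? S) (words n (suc L))
      ≡⟨ count-words-suc-avoiding {L = L} (PZ≟ (suc k)) _ S-letters count-fresh ⟩
    count ((PZ≟ (suc k) ∘ (0 ∷_)) ∩? avoids? S) (words n L) + a * rookCountPZ (pred a) L k
      ≡⟨ cong (_+ a * rookCountPZ (pred a) L k)
              (count-none _ (λ _ (0≡1+k , _) → ℕP.0≢1+n 0≡1+k) (words n L)) ⟩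
    a * rookCountPZ (pred a) L k ∎
    where
    open ≡-Reasoning
    a = n ∸ length S
    suc-first : ∀ {b S′} → (λ w → PZ (suc b ∷ w) ≡ suc k × Avoids S′ w) ≐ (λ w → PZ w ≡ k × Avoids S′ w)
    suc-first = (λ (e , avoids) → ℕP.suc-injective e , avoids) , (λ (e , avoids) → cong suc e , avoids)
    count-fresh : ∀ b → b < n → LetterSet n (suc b ∷ S) →
      count ((PZ≟ (suc k) ∘ (suc b ∷_)) ∩? avoids? (suc b ∷ S)) (words n L) ≡ rookCountPZ (pred a) L k
    count-fresh b _ bS-letters = begin
      count ((PZ≟ (suc k) ∘ (suc b ∷_)) ∩? avoids? (suc b ∷ S)) (words n L)
        ≡⟨ count-≐ _ (PZ≟ k ∩? avoids? (suc b ∷ S)) (suc-first {b}) (words n L) ⟩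
      count (PZ≟ k ∩? avoids? (suc b ∷ S)) (words n L)
        ≡⟨ count-avoiding-PZ L k bS-letters ⟩
      rookCountPZ (n ∸ suc (length S)) L k
        ≡⟨ cong (λ a′ → rookCountPZ a′ L k) (ℕP.pred[m∸n]≡m∸[1+n] n (length S)) ⟨
      rookCountPZ (pred a) L k ∎

  rℕ≡rookCountPZ : ∀ n k → rℕ n k ≡ rookCountPZ n n k
  rℕ≡rookCountPZ n k = trans (count-filter (PZ≟ k) isRook? (words n n)) (count-avoiding-PZ {n} n k ([] , []))

  rookCountPZ-beyond : ∀ a {L k} → L < k → rookCountPZ a L k ≡ 0
  rookCountPZ-beyond a {zero} {suc k} _ = refl
  rookCountPZ-beyond a {suc L} {suc k} (s≤s L<k) =
    trans (cong (a *_) (rookCountPZ-beyond (pred a) L<k)) (ℕP.*-zeroʳ a)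

  ∑-rookCountPZ : ∀ a L {c} → L < c → ∑[ k < c ] rookCountPZ a L k ≡ rookCount a L
  ∑-rookCountPZ a zero {suc c} _ = cong suc (∑-zero c)
  ∑-rookCountPZ a (suc L) {suc c} (s≤s L<c) =
    cong (rookCount a L +_) (trans (∑-*ˡ c a _) (cong (a *_) (∑-rookCountPZ (pred a) L L<c)))

  rookCount-suc-letters : ∀ a L → rookCount (suc a) (suc L) ≡ rookCount a (suc L) + suc L * rookCount a L
  rookCount-suc-letters a zero = solve a
    where
    solve : ∀ a → 1 + suc a * 1 ≡ (1 + a * 1) + 1 * 1
    solve = solve-∀
  rookCount-suc-letters a (suc L) = begin
    rookCount (suc a) (suc L) + suc a * R₁
      ≡⟨ cong (_+ suc a * R₁) (rookCount-suc-letters a L) ⟩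
    R₁ + suc L * X + suc a * R₁
      ≡⟨ regroup L a X Y Z (new-letter a) ⟩
    R₁ + a * Z + suc (suc L) * R₁ ∎
    where
    open ≡-Reasoning
    X = rookCount a L
    Y = rookCount (pred a) L
    Z = rookCount (pred a) (suc L)
    R₁ = rookCount a (suc L)
    new-letter : ∀ a → a * rookCount a (suc L) ≡ a * (rookCount (pred a) (suc L) + suc L * rookCount (pred a) L)
    new-letter zero = refl
    new-letter (suc b) = cong (suc b *_) (rookCount-suc-letters b L)
    regroup : ∀ L a X Y Z → a * (X + a * Y) ≡ a * (Z + suc L * Y) →
      (X + a * Y) + suc L * X + suc a * (X + a * Y) ≡ (X + a * Y) + a * Z + suc (suc L) * (X + a * Y)
    regroup L a X Y Z eq = begin
      (X + a * Y) + suc L * X + suc a * (X + a * Y)        ≡⟨ expand L a X Y ⟩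
      (X + a * Y) + suc L * X + (X + a * Y) + a * (X + a * Y)
        ≡⟨ cong ((X + a * Y) + suc L * X + (X + a * Y) +_) eq ⟩
      (X + a * Y) + suc L * X + (X + a * Y) + a * (Z + suc L * Y)
        ≡⟨ collect L a X Y Z ⟩
      (X + a * Y) + a * Z + suc (suc L) * (X + a * Y)      ∎
      where
      expand : ∀ L a X Y → (X + a * Y) + suc L * X + suc a * (X + a * Y) ≡ (X + a * Y) + suc L * X + (X + a * Y) + a * (X + a * Y)
      expand = solve-∀
      collect : ∀ L a X Y Z → (X + a * Y) + suc L * X + (X + a * Y) + a * (Z + suc L * Y) ≡ (X + a * Y) + a * Z + suc (suc L) * (X + a * Y)
      collect = solve-∀

  rookCount-suc-diagonal : ∀ m → rookCount (suc m) m ≡ m * rookCountPZ m m 0 + rookCount m m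
  rookCount-suc-diagonal zero = refl
  rookCount-suc-diagonal (suc m) = trans (rookCount-suc-letters (suc m) m) (ℕP.+-comm (rookCount (suc m) (suc m)) _)

  rookCountPZ-tail : ∀ m j → j ≤ m →
    (m ∸ j) * rookCountPZ m m j ≡
      (m ∸ suc j) * rookCountPZ m m (suc j) + ∑[ t < suc (m ∸ j) ] rookCountPZ m m (suc j + t)
  rookCountPZ-tail zero zero _ = refl
  rookCountPZ-tail (suc m) zero _ = begin
    suc m * rookCount (suc m) m
      ≡⟨ cong (suc m *_) (rookCount-suc-diagonal m) ⟩
    suc m * (m * rookCountPZ m m 0 + rookCount m m)
      ≡⟨ distribute (suc m) m (rookCountPZ m m 0) (rookCount m m) ⟩
    m * (suc m * rookCountPZ m m 0) + suc m * rookCount m m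
      ≡⟨ cong (m * (suc m * rookCountPZ m m 0) +_) sum-shifted ⟨
    m * (suc m * rookCountPZ m m 0) + ∑[ t < suc (suc m) ] (suc m * rookCountPZ m m t) ∎
    where
    open ≡-Reasoning
    distribute : ∀ M m x y → M * (m * x + y) ≡ m * (M * x) + M * y
    distribute = solve-∀
    sum-shifted : ∑[ t < suc (suc m) ] (suc m * rookCountPZ m m t) ≡ suc m * rookCount m m
    sum-shifted = trans (∑-*ˡ (suc (suc m)) (suc m) (rookCountPZ m m)) (cong (suc m *_) (∑-rookCountPZ m m (ℕP.m≤n⇒m≤1+n (ℕP.n<1+n m))))
  rookCountPZ-tail (suc m) (suc j) (s≤s j≤m) = begin
    (m ∸ j) * (suc m * f j)
      ≡⟨ *-left-comm (m ∸ j) (suc m) (f j) ⟩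
    suc m * ((m ∸ j) * f j)
      ≡⟨ cong (suc m *_) (rookCountPZ-tail m j j≤m) ⟩
    suc m * ((m ∸ suc j) * f (suc j) + ∑[ t < suc (m ∸ j) ] f (suc j + t))
      ≡⟨ ℕP.*-distribˡ-+ (suc m) ((m ∸ suc j) * f (suc j)) _ ⟩
    suc m * ((m ∸ suc j) * f (suc j)) + suc m * ∑[ t < suc (m ∸ j) ] f (suc j + t)
      ≡⟨ cong₂ _+_ (*-left-comm (m ∸ suc j) (suc m) (f (suc j))) (∑-*ˡ (suc (m ∸ j)) (suc m) (f ∘ (suc j +_))) ⟨
    (m ∸ suc j) * (suc m * f (suc j)) + ∑[ t < suc (m ∸ j) ] (suc m * f (suc j + t)) ∎
    where
    open ≡-Reasoning
    f = rookCountPZ m m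

  rookCountPZ-recurrence : ∀ m k → k ≤ suc m →
    rookCountPZ (suc m) (suc m) k ≡
      k * rookCountPZ m m (pred k) + (m ∸ k) * rookCountPZ m m k + ∑[ t < suc (suc m ∸ k) ] rookCountPZ m m (k + t)
  rookCountPZ-recurrence m zero _ =
    trans (rookCount-suc-diagonal m)
          (cong (m * rookCountPZ m m 0 +_) (sym (∑-rookCountPZ m m (ℕP.m≤n⇒m≤1+n (ℕP.n<1+n m)))))
  rookCountPZ-recurrence m (suc j) (s≤s j≤m) = begin
    suc m * f j                                              ≡⟨ cong (λ n → suc n * f j) (ℕP.m+[n∸m]≡n j≤m) ⟨
    (suc j + (m ∸ j)) * f j                                  ≡⟨ ℕP.*-distribʳ-+ (f j) (suc j) (m ∸ j) ⟩
    suc j * f j + (m ∸ j) * f j                              ≡⟨ cong (suc j * f j +_) (rookCountPZ-tail m j j≤m) ⟩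
    suc j * f j + ((m ∸ suc j) * f (suc j) + ∑[ t < suc (m ∸ j) ] f (suc j + t))
                                                             ≡⟨ ℕP.+-assoc (suc j * f j) _ _ ⟨
    suc j * f j + (m ∸ suc j) * f (suc j) + ∑[ t < suc (m ∸ j) ] f (suc j + t) ∎
    where
    open ≡-Reasoning
    f = rookCountPZ m m

open RookCounting using (∑<; ∑-snoc; rookCountPZ; rookCountPZ-beyond; rℕ≡rookCountPZ; rookCountPZ-recurrence)
open import Data.Integer using (ℤ; +_; _+_; _*_; _-_)
import Data.Integer.Properties as ℤP

r≡rookCountPZ : ∀ n i → r n (+ i) ≡ + rookCountPZ n n i
r≡rookCountPZ n i with i ℕ.≤? n
... | yes _ = cong +_ (rℕ≡rookCountPZ n i)
... | no i≰n = cong +_ (sym (rookCountPZ-beyond n (ℕP.≰⇒> i≰n)))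

sumFrom-pos : (f : ℤ → ℤ) (g : ℕ → ℕ) → ∀ k → (∀ t → f (+ (k ℕ.+ t)) ≡ + g t) →
  ∀ c → sumFrom (+ k) c f ≡ + ∑< c g
sumFrom-pos f g k f≡g zero = refl
sumFrom-pos f g k f≡g (suc c) = trans (cong₂ _+_ (sumFrom-pos f g k f≡g c) (f≡g c)) (cong +_ (sym (∑-snoc c g)))

m-n≡m∸n : ∀ {m n} → n ≤ m → + m - + n ≡ + (m ∸ n)
m-n≡m∸n {m} {n} n≤m = trans (ℤP.m-n≡m⊖n m n) (ℤP.⊖-≥ n≤m)

countFromTo-pos : ∀ {k l} → k ≤ l → countFromTo (+ k) (+ l) ≡ suc (l ∸ k)
countFromTo-pos k≤l rewrite m-n≡m∸n k≤l = refl

sumFromTo-r : ∀ m k → k ≤ suc m →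
  sumFromTo (+ k) (+ suc m) (λ i → r m i) ≡ + ∑[ t < suc (suc m ∸ k) ] rookCountPZ m m (k ℕ.+ t)
sumFromTo-r m k k≤1+m =
  trans (cong (λ c → sumFrom (+ k) c (r m)) (countFromTo-pos k≤1+m))
        (sumFrom-pos (r m) _ k (λ t → r≡rookCountPZ m (k ℕ.+ t)) (suc (suc m ∸ k)))

shifted-term : ∀ m k → + k * r m (+ k - + 1) ≡ + (k ℕ.* rookCountPZ m m (pred k))
shifted-term m zero = refl
shifted-term m (suc j) = trans (cong (+ suc j *_) (r≡rookCountPZ m j)) (sym (ℤP.pos-* (suc j) _))

-- At k = suc m the coefficient is -1, but then r m (+ k) vanishes.
unshifted-term : ∀ m k → k ≤ suc m → (+ suc m - + k - + 1) * r m (+ k) ≡ + ((m ∸ k) ℕ.* rookCountPZ m m k)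
unshifted-term m k k≤1+m with ℕP.m≤n⇒m<n∨m≡n k≤1+m
... | inj₁ (s≤s k≤m) = begin
  (+ suc m - + k - + 1) * r m (+ k)    ≡⟨ cong₂ _*_ coefficient (r≡rookCountPZ m k) ⟩
  + (m ∸ k) * + rookCountPZ m m k      ≡⟨ ℤP.pos-* (m ∸ k) _ ⟨
  + ((m ∸ k) ℕ.* rookCountPZ m m k)    ∎
  where
  open ≡-Reasoning
  coefficient : + suc m - + k - + 1 ≡ + (m ∸ k)
  coefficient = cong (_- + 1) (trans (m-n≡m∸n (ℕP.m≤n⇒m≤1+n k≤m)) (cong +_ (ℕP.+-∸-assoc 1 k≤m)))
... | inj₂ refl = begin
  c * r m (+ suc m)                            ≡⟨ cong (c *_) (r≡rookCountPZ m (suc m)) ⟩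
  c * + rookCountPZ m m (suc m)                ≡⟨ cong (λ x → c * + x) beyond ⟩
  c * + 0                                      ≡⟨ ℤP.*-zeroʳ c ⟩
  + 0                                          ≡⟨ cong +_ (ℕP.*-zeroʳ (m ∸ suc m)) ⟨
  + ((m ∸ suc m) ℕ.* 0)                        ≡⟨ cong (λ x → + ((m ∸ suc m) ℕ.* x)) beyond ⟨
  + ((m ∸ suc m) ℕ.* rookCountPZ m m (suc m))  ∎
  where
  open ≡-Reasoning
  c = + suc m - + suc m - + 1
  beyond : rookCountPZ m m (suc m) ≡ 0
  beyond = rookCountPZ-beyond m {m} ℕP.≤-refl

lemma3p29 : (m k : ℕ) → k ≤ suc m →
    r (suc m) (+ k) ≡ + k * r m (+ k - + 1) + (+ suc m - + k - + 1) * r m (+ k) + sumFromTo (+ k) (+ suc m) (λ i → r m i)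
lemma3p29 m k k≤1+m = begin
  r (suc m) (+ k)
    ≡⟨ r≡rookCountPZ (suc m) k ⟩
  + rookCountPZ (suc m) (suc m) k
    ≡⟨ cong +_ (rookCountPZ-recurrence m k k≤1+m) ⟩
  + (k ℕ.* f (pred k)) + + ((m ∸ k) ℕ.* f k) + + ∑[ t < suc (suc m ∸ k) ] f (k ℕ.+ t)
    ≡⟨ cong₂ _+_ (cong₂ _+_ (shifted-term m k) (unshifted-term m k k≤1+m)) (sumFromTo-r m k k≤1+m) ⟨
  + k * r m (+ k - + 1) + (+ suc m - + k - + 1) * r m (+ k) + sumFromTo (+ k) (+ suc m) (λ i → r m i) ∎
  where
  open ≡-Reasoning
  f = rookCountPZ m m
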